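{- Let $\Sigma,\Gamma$ be finite alphabets and $\pi:\Sigma\times m\to\Gamma$ a well-defined interpretation. Then its strictification $\pi':\Sigma_\square\times m\to\Gamma$ is well-defined and strict, and $d\circ[\![\pi']\!]=[\![\pi]\!]$.
   Context: Strings as structures: a string $s\in\Sigma^\star$ is identified with the structure with domain $\{0,\dots,|s|-1\}$, unary predicates $\sigma$ ($\sigma\in\Sigma$) true at indices carrying $\sigma$, $\min$ (true only at $0$), $\max$ (true only at $|s|-1$), and functions $\mathrm{S}$ ($x\mapsto x+1$, fixing $|s|-1$), $\mathrm{P}$ ($x\mapsto x-1$, fixing $0$). BMRS: terms over a single variable $\mathtt{x}$: index terms $\mathtt{x},\mathrm{S}(T),\mathrm{P}(T)$ and index if-then-else; boolean terms $\mathtt{tt},\mathtt{ff},\mathtt{f}(T),\sigma(T),\max(T),\min(T)$ ($T$ an index term, $\mathtt{f}$ a recursive function name) and boolean $\mathtt{if}\ T_0\ \mathtt{then}\ T_1\ \mathtt{else}\ T_2$. A headless BMRS is a finite set of recursive definitions $\mathtt{f}_i(\mathtt{x})=T_i$ with boolean bodies; evaluation $s,x\vdash T\to v$ is the standard least big-step relation ($\mathtt{x}\to x$, $\mathrm{S},\mathrm{P},\min,\max,\sigma$ interpreted in $s$, a call $\mathtt{f}_i(T)$ evaluates $T$ to $v$ and then $T_i$ at $v$, if-then-else evaluates guard then branch). A BMRS is a headless BMRS plus finitely many terms called heads. Interpretations: $\pi:\Sigma\times m\to\Gamma$ is a $\Gamma$-BMRS with heads $\pi(\sigma,i)$ ($\sigma\in\Sigma,i<m$).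 Well-defined: for all $s\in\Gamma^\star$, $i<m$, $x<|s|$, $s,x\vdash\pi(\sigma,i)\to\top$ for at most one $\sigma$ and $s,x\vdash\pi(\tau,i)\to\bot$ for all other $\tau$; strict: exactly one such $\sigma$. For well-defined $\pi$ and $s\in\Gamma^\star$, let $J$ be the set of $(q,r)\in|s|\times m$ with $s,q\vdash\pi(\sigma,r)\to\top$ for some $\sigma$, ordered lexicographically ($q$ more significant); $[\![\pi]\!](s)$ has length $|J|$ and carries $\sigma$ at $x$ iff $s,q\vdash\pi(\sigma,r)\to\top$ for the element $(q,r)$ of $J$ with $x$ predecessors. Blanks: $\square$ is a fresh symbol, $\Sigma_\square=\Sigma\cup\{\square\}$, $d:\Sigma_\square^\star\to\Sigma^\star$ deletes all $\square$. Strictification: $\pi':\Sigma_\square\times m\to\Gamma$ has the same body as $\pi$, heads $\pi'(\sigma,i)=\pi(\sigma,i)$ for $\sigma\in\Sigma$, and $\pi'(\square,i)$ a boolean term (nested if-then-else) expressing $\bigwedge_{\sigma\in\Sigma}\neg\pi(\sigma,i)$. -}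

module Defs where

open import Data.Nat using (ℕ; zero; suc; _<_; _<ᵇ_; _≡ᵇ_; _∸_)
open import Data.Fin using (Fin; toℕ)
open import Data.Fin.Properties using () renaming (_≟_ to _≟ᶠ_)
open import Data.Bool using (Bool; true; false; if_then_else_)
open import Data.List using (List; []; _∷_; length; concatMap; allFin; lookup)
open import Data.Maybe using (Maybe; just; nothing)
open import Data.Product using (Σ; ∃; _×_; _,_)
open import Data.Sum using (_⊎_)
open import Relation.Nullary using (¬_; does)
open import Relation.Binary.PropositionalEquality using (_≡_; _≢_)
open import Function.Bundles using (_⇔_)

-- Strings over an alphabet Γ = Fin g are lists; positions are naturals
-- (only positions x < length s are meaningful).

succS : ∀ {g} → List (Fin g) → ℕ → ℕ
succS s x = if suc x <ᵇ length s then suc x else x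

predS : ℕ → ℕ
predS x = x ∸ 1

carries : ∀ {g} → List (Fin g) → ℕ → Fin g → Bool
carries []      _       γ = false
carries (c ∷ s) zero    γ = does (c ≟ᶠ γ)
carries (c ∷ s) (suc x) γ = carries s x γ

isMax : ∀ {g} → List (Fin g) → ℕ → Bool
isMax s x = suc x ≡ᵇ length s

isMin : ℕ → Bool
isMin x = x ≡ᵇ 0

-- BMRS terms over one variable x, with k recursive function names
-- (Fin k) and input alphabet Γ = Fin g.

mutual
  data ITerm (k g : ℕ) : Set where
    var  : ITerm k g
    S    : ITerm k g → ITerm k g
    P    : ITerm k g → ITerm k g
    iteI : BTerm k g → ITerm k g → ITerm k g → ITerm k g

  data BTerm (k g : ℕ) : Set where
    tt ff : BTerm k g
    call  : Fin k → ITerm k g → BTerm k g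
    sym   : Fin g → ITerm k g → BTerm k g
    max   : ITerm k g → BTerm k g
    min   : ITerm k g → BTerm k g
    iteB  : BTerm k g → BTerm k g → BTerm k g → BTerm k g

HeadlessBMRS : ℕ → ℕ → Set
HeadlessBMRS k g = Fin k → BTerm k g

-- Big-step evaluation  s , x ⊢ T → v  (least relation = inductive type)

mutual
  data EvI {k g} (body : HeadlessBMRS k g) (s : List (Fin g)) :
           ℕ → ITerm k g → ℕ → Set where
    ev-var : ∀ {x} → EvI body s x var x
    ev-S   : ∀ {x T v} → EvI body s x T v → EvI body s x (S T) (succS s v)
    ev-P   : ∀ {x T v} → EvI body s x T v → EvI body s x (P T) (predS v)
    ev-iteI-t : ∀ {x T₀ T₁ T₂ v} → EvB body s x T₀ true →
                EvI body s x T₁ v → EvI body s x (iteI T₀ T₁ T₂) v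
    ev-iteI-f : ∀ {x T₀ T₁ T₂ v} → EvB body s x T₀ false →
                EvI body s x T₂ v → EvI body s x (iteI T₀ T₁ T₂) v

  data EvB {k g} (body : HeadlessBMRS k g) (s : List (Fin g)) :
           ℕ → BTerm k g → Bool → Set where
    ev-tt   : ∀ {x} → EvB body s x tt true
    ev-ff   : ∀ {x} → EvB body s x ff false
    ev-call : ∀ {x f T v b} → EvI body s x T v → EvB body s v (body f) b →
              EvB body s x (call f T) b
    ev-sym  : ∀ {x γ T v} → EvI body s x T v →
              EvB body s x (sym γ T) (carries s v γ)
    ev-max  : ∀ {x T v} → EvI body s x T v → EvB body s x (max T) (isMax s v)
    ev-min  : ∀ {x T v} → EvI body s x T v → EvB body s x (min T) (isMin v)
    ev-iteB-t : ∀ {x T₀ T₁ T₂ b} → EvB body s x T₀ true →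
                EvB body s x T₁ b → EvB body s x (iteB T₀ T₁ T₂) b
    ev-iteB-f : ∀ {x T₀ T₁ T₂ b} → EvB body s x T₀ false →
                EvB body s x T₂ b → EvB body s x (iteB T₀ T₁ T₂) b

-- Interpretations π : A × m → Γ : a Γ-BMRS with heads π(σ,i).

record Interp (k g : ℕ) (A : Set) (m : ℕ) : Set where
  field
    body : HeadlessBMRS k g
    head : A → Fin m → BTerm k g
open Interp public

_,_⊢_⇓_ : ∀ {k g A m} → Interp k g A m → List (Fin g) → ℕ → BTerm k g → Bool → Set
_,_⊢_⇓_ π s x T b = EvB (body π) s x T b

WellDefined : ∀ {k g A m} → Interp k g A m → Set
WellDefined {g = g} {A} {m} π =
  (s : List (Fin g)) (i : Fin m) (x : ℕ) → x < length s →
    (Σ A λ σ → (π , s ⊢ x ⇓ head π σ i) true ×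
               ((τ : A) → τ ≢ σ → (π , s ⊢ x ⇓ head π τ i) false))
    ⊎ ((τ : A) → (π , s ⊢ x ⇓ head π τ i) false)

Strict : ∀ {k g A m} → Interp k g A m → Set
Strict {g = g} {A} {m} π =
  (s : List (Fin g)) (i : Fin m) (x : ℕ) → x < length s →
    Σ A λ σ → (π , s ⊢ x ⇓ head π σ i) true ×
              ((τ : A) → τ ≢ σ → (π , s ⊢ x ⇓ head π τ i) false)

-- Semantics [[π]](s) as a relation  Out π s t  ("[[π]](s) = t").
-- Cell π s q r c : c = [σ] if π(σ,r) → ⊤ at q, and c = [] if (q,r) ∉ J.
data Cell {k g A m} (π : Interp k g A m) (s : List (Fin g)) (q : ℕ) (r : Fin m) :
          List A → Set where
  inJ    : (σ : A) → (π , s ⊢ q ⇓ head π σ r) true → Cell π s q r (σ ∷ [])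
  notInJ : (¬ Σ A λ σ → (π , s ⊢ q ⇓ head π σ r) true) → Cell π s q r []

Out : ∀ {k g A m} → Interp k g A m → List (Fin g) → List A → Set
Out {A = A} {m} π s t =
  Σ ((q : Fin (length s)) → Fin m → List A) λ cells →
    ((q : Fin (length s)) (r : Fin m) → Cell π s (toℕ q) r (cells q r)) ×
    t ≡ concatMap (λ q → concatMap (λ r → cells q r) (allFin m)) (allFin (length s))

-- Blanks: Σ_□ = Maybe Σ with □ = nothing; d deletes all blanks.

d : ∀ {A : Set} → List (Maybe A) → List A
d []             = []
d (nothing ∷ t)  = d t
d (just σ ∷ t)   = σ ∷ d t

noneOf : ∀ {k g A m} → Interp k g A m → Fin m → List A → BTerm k g
noneOf π i []       = tt
noneOf π i (σ ∷ σs) = iteB (head π σ i) ff (noneOf π i σs)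

strictify : ∀ {k g n m} → Interp k g (Fin n) m → Interp k g (Maybe (Fin n)) m
strictify {n = n} π = record
  { body = body π
  ; head = λ { (just σ) i → head π σ i
             ; nothing  i → noneOf π i (allFin n) } }

-- The blank head of the strictification fires exactly when no head of π
-- fires, so under well-definedness exactly one head of π' fires at every
-- cell. A cell of π' is thus the corresponding cell of π, except that an
-- empty cell becomes □, which d erases; as the output of a well-defined
-- interpretation is unique, [[π]](s) = d ([[π']](s)).
module Submission where

open import Defs
open import Data.Nat using (_<_)
open import Data.Fin using (Fin; toℕ)
open import Data.Fin.Properties using (toℕ<n) renaming (_≟_ to _≟ᶠ_)
open import Data.Maybe using (Maybe; just; nothing)
open import Data.List using (List; []; _∷_; _++_; concatMap; allFin; length)
open import Data.List.Properties using (concatMap-cong)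
open import Data.List.Relation.Unary.All as All using (All; []; _∷_)
open import Data.List.Relation.Unary.Any using (here; there)
open import Data.List.Membership.Propositional using (_∈_)
open import Data.List.Membership.Propositional.Properties using (∈-allFin)
open import Data.Bool using (true; false)
open import Data.Product using (Σ; _×_; _,_; proj₁; proj₂)
open import Data.Sum using (inj₁; inj₂)
open import Relation.Nullary using (¬_; yes; no; contradiction)
open import Relation.Binary.Definitions using (DecidableEquality)
open import Relation.Binary.PropositionalEquality
  using (_≡_; _≢_; refl; cong; trans)
  renaming (sym to ≡-sym)
open import Function.Bundles using (_⇔_; mk⇔)

mutual
  EvI-deterministic : ∀ {k g} {bd : HeadlessBMRS k g} {s x T v v'} →
                      EvI bd s x T v → EvI bd s x T v' → v ≡ v'
  EvI-deterministic ev-var          ev-var            = refl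
  EvI-deterministic (ev-S e)        (ev-S e')         = cong _ (EvI-deterministic e e')
  EvI-deterministic (ev-P e)        (ev-P e')         = cong _ (EvI-deterministic e e')
  EvI-deterministic (ev-iteI-t _ e) (ev-iteI-t _ e')  = EvI-deterministic e e'
  EvI-deterministic (ev-iteI-f _ e) (ev-iteI-f _ e')  = EvI-deterministic e e'
  EvI-deterministic (ev-iteI-t c _) (ev-iteI-f c' _) with () ← EvB-deterministic c c'
  EvI-deterministic (ev-iteI-f c _) (ev-iteI-t c' _) with () ← EvB-deterministic c c'

  EvB-deterministic : ∀ {k g} {bd : HeadlessBMRS k g} {s x T b b'} →
                      EvB bd s x T b → EvB bd s x T b' → b ≡ b'
  EvB-deterministic ev-tt           ev-tt             = refl
  EvB-deterministic ev-ff           ev-ff             = refl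
  EvB-deterministic (ev-call a e)   (ev-call a' e')   with refl ← EvI-deterministic a a' =
    EvB-deterministic e e'
  EvB-deterministic (ev-sym e)      (ev-sym e')       = cong _ (EvI-deterministic e e')
  EvB-deterministic (ev-max e)      (ev-max e')       = cong _ (EvI-deterministic e e')
  EvB-deterministic (ev-min e)      (ev-min e')       = cong _ (EvI-deterministic e e')
  EvB-deterministic (ev-iteB-t _ e) (ev-iteB-t _ e')  = EvB-deterministic e e'
  EvB-deterministic (ev-iteB-f _ e) (ev-iteB-f _ e')  = EvB-deterministic e e'
  EvB-deterministic (ev-iteB-t c _) (ev-iteB-f c' _) with () ← EvB-deterministic c c'
  EvB-deterministic (ev-iteB-f c _) (ev-iteB-t c' _) with () ← EvB-deterministic c c'

EvB-true⇒¬false : ∀ {k g} {bd : HeadlessBMRS k g} {s x T} →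
                  EvB bd s x T true → ¬ EvB bd s x T false
EvB-true⇒¬false e e' with () ← EvB-deterministic e e'

d-++ : ∀ {A : Set} (xs ys : List (Maybe A)) → d (xs ++ ys) ≡ d xs ++ d ys
d-++ []             ys = refl
d-++ (nothing ∷ xs) ys = d-++ xs ys
d-++ (just x ∷ xs)  ys = cong (x ∷_) (d-++ xs ys)

d-concatMap : ∀ {A B : Set} (f : B → List (Maybe A)) (xs : List B) →
              d (concatMap f xs) ≡ concatMap (λ x → d (f x)) xs
d-concatMap f []       = refl
d-concatMap f (x ∷ xs) = trans (d-++ (f x) (concatMap f xs))
                               (cong (d (f x) ++_) (d-concatMap f xs))

module _ {k g m} {A : Set} (π : Interp k g A m) where

  noneOf-true : ∀ {s x i} (l : List A) →
                All (λ τ → (π , s ⊢ x ⇓ head π τ i) false) l →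
                (π , s ⊢ x ⇓ noneOf π i l) true
  noneOf-true []      []       = ev-tt
  noneOf-true (τ ∷ l) (e ∷ es) = ev-iteB-f e (noneOf-true l es)

  noneOf-true⁻ : ∀ {s x i} (l : List A) → (π , s ⊢ x ⇓ noneOf π i l) true →
                 All (λ τ → (π , s ⊢ x ⇓ head π τ i) false) l
  noneOf-true⁻ []      _                = []
  noneOf-true⁻ (τ ∷ l) (ev-iteB-f e es) = e ∷ noneOf-true⁻ l es

  Strict⇒WellDefined : Strict π → WellDefined π
  Strict⇒WellDefined strict s i x x<∣s∣ = inj₁ (strict s i x x<∣s∣)

  Strict⇒Out : Strict π → (s : List (Fin g)) → Σ (List A) (Out π s)
  Strict⇒Out strict s =
    _ , (λ q r → proj₁ (fires q r) ∷ []) , (λ q r → inJ _ (proj₁ (proj₂ (fires q r)))) , refl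
    where
    fires : (q : Fin (length s)) (r : Fin m) → Σ A λ σ →
            (π , s ⊢ toℕ q ⇓ head π σ r) true ×
            ((τ : A) → τ ≢ σ → (π , s ⊢ toℕ q ⇓ head π τ r) false)
    fires q r = strict s r (toℕ q) (toℕ<n q)

module _ {k g m} {A : Set} (_≟_ : DecidableEquality A) (π : Interp k g A m) where

  noneOf-false : ∀ {s x i σ} (l : List A) → σ ∈ l → (π , s ⊢ x ⇓ head π σ i) true →
                 ((τ : A) → τ ≢ σ → (π , s ⊢ x ⇓ head π τ i) false) →
                 (π , s ⊢ x ⇓ noneOf π i l) false
  noneOf-false {σ = σ} (τ ∷ l) _ σ-true others-false with τ ≟ σ
  ... | yes refl = ev-iteB-t σ-true ev-ff
  noneOf-false (τ ∷ l) (here refl) σ-true others-false | no τ≢τ = contradiction refl τ≢τ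
  noneOf-false (τ ∷ l) (there σ∈l) σ-true others-false | no τ≢σ =
    ev-iteB-f (others-false τ τ≢σ) (noneOf-false l σ∈l σ-true others-false)

  WellDefined⇒head-unique : WellDefined π → ∀ {s x i σ τ} → x < length s →
                            (π , s ⊢ x ⇓ head π σ i) true → (π , s ⊢ x ⇓ head π τ i) true →
                            σ ≡ τ
  WellDefined⇒head-unique wd {s} {x} {i} {σ} {τ} x<∣s∣ σ-true τ-true with wd s i x x<∣s∣
  ... | inj₂ all-false = contradiction (all-false σ) (EvB-true⇒¬false σ-true)
  ... | inj₁ (ρ , _ , others-false) with σ ≟ ρ | τ ≟ ρ
  ...   | yes σ≡ρ | yes τ≡ρ = trans σ≡ρ (≡-sym τ≡ρ)
  ...   | no σ≢ρ  | _       = contradiction (others-false σ σ≢ρ) (EvB-true⇒¬false σ-true)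
  ...   | _       | no τ≢ρ  = contradiction (others-false τ τ≢ρ) (EvB-true⇒¬false τ-true)

  Cell-unique : WellDefined π → ∀ {s q r c c'} → q < length s →
                Cell π s q r c → Cell π s q r c' → c ≡ c'
  Cell-unique wd q<∣s∣ (inJ σ σ-true) (inJ τ τ-true) =
    cong (_∷ []) (WellDefined⇒head-unique wd q<∣s∣ σ-true τ-true)
  Cell-unique wd q<∣s∣ (inJ σ σ-true) (notInJ none) = contradiction (σ , σ-true) none
  Cell-unique wd q<∣s∣ (notInJ none)  (inJ τ τ-true) = contradiction (τ , τ-true) none
  Cell-unique wd q<∣s∣ (notInJ _)     (notInJ _)     = refl

  Out-unique : WellDefined π → ∀ {s t t'} → Out π s t → Out π s t' → t ≡ t'
  Out-unique wd {s} (_ , cells , refl) (_ , cells' , refl) =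
    concatMap-cong (λ q → concatMap-cong
                     (λ r → Cell-unique wd (toℕ<n q) (cells q r) (cells' q r)) (allFin m))
                   (allFin (length s))

module _ {k g n m} (π : Interp k g (Fin n) m) where

  strictify-Strict : WellDefined π → Strict (strictify π)
  strictify-Strict wd s i x x<∣s∣ with wd s i x x<∣s∣
  ... | inj₁ (σ , σ-true , others-false) =
    just σ , σ-true , λ
      { (just τ) τ≢σ → others-false τ (λ τ≡σ → τ≢σ (cong just τ≡σ))
      ; nothing  _   → noneOf-false _≟ᶠ_ π (allFin n) (∈-allFin σ) σ-true others-false }
  ... | inj₂ all-false =
    nothing , noneOf-true π (allFin n) (All.tabulate λ {τ} _ → all-false τ) , λ
      { (just τ) _       → all-false τ
      ; nothing  □≢□ → contradiction refl □≢□ }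

  strictify-Cell : ∀ {s q r c} → Cell (strictify π) s q r c → Cell π s q r (d c)
  strictify-Cell (inJ (just σ) σ-true) = inJ σ σ-true
  strictify-Cell (inJ nothing □-true)  = notInJ λ (σ , σ-true) →
    EvB-true⇒¬false σ-true (All.lookup (noneOf-true⁻ π (allFin n) □-true) (∈-allFin σ))
  strictify-Cell (notInJ none)         = notInJ λ (σ , σ-true) → none (just σ , σ-true)

  strictify-Out : ∀ {s t} → Out (strictify π) s t → Out π s (d t)
  strictify-Out {s} (cells , cells-ok , refl) =
    (λ q r → d (cells q r)) , (λ q r → strictify-Cell (cells-ok q r)) ,
    trans (d-concatMap _ (allFin (length s)))
          (concatMap-cong (λ q → d-concatMap (cells q) (allFin m)) (allFin (length s)))

lemma2 : ∀ {k g n m} (π : Interp k g (Fin n) m) → WellDefined π →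
           WellDefined (strictify π) × Strict (strictify π) ×
           ((s : List (Fin g)) → Σ (List (Maybe (Fin n))) (λ t → Out (strictify π) s t)) ×
           ((s : List (Fin g)) (t : List (Maybe (Fin n))) (u : List (Fin n)) →
              Out (strictify π) s t → (Out π s u ⇔ d t ≡ u))
lemma2 π wd =
  Strict⇒WellDefined (strictify π) strict ,
  strict ,
  Strict⇒Out (strictify π) strict ,
  λ s t u out′ → mk⇔ (Out-unique _≟ᶠ_ π wd (strictify-Out π out′))
                     (λ { refl → strictify-Out π out′ })
  where
  strict : Strict (strictify π)
  strict = strictify-Strict π wd
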